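{- Let $h,m$ be positive integers with $h=1$ or $\omega(m)=1$, and let $c$ be an upper bound on the arities $n$ for which $\mathrm{AND}_n$ is computable by a $\mathrm{CC}_h[m]$-circuit. Then every non-constant boolean function computable by a $\mathrm{CC}_h[m]$-circuit has balance at least $2^{1-c}$.
   Context: For $A\subseteq\{0,\dots,m-1\}$, the gate $\mathrm{MOD}_m^A$ (unbounded fan-in) outputs $1$ iff the sum of its boolean inputs modulo $m$ lies in $A$; multiple wires are allowed. A $\mathrm{CC}_h[m]$-circuit is a depth-$h$ circuit built of gates $\mathrm{MOD}_m^A$. $\omega(m)$ is the number of distinct prime divisors of $m$. (Such a bound $c$ exists in this case.) The balance of an $n$-ary boolean function $f$ is $\mathrm{bal}(f)=1-\frac{\left|\,|f^{ -1}(0)|-|f^{ -1}(1)|\,\right|}{2^n}$. -}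

module Defs where

open import Data.Nat using (ℕ; zero; suc; _+_; _^_; _%_; _≤_; NonZero)
open import Data.Nat.Properties using (m^n≢0)
open import Data.Nat.DivMod using (m%n<n)
open import Data.Nat.Divisibility using (_∣_; _∣?_)
open import Data.Nat.Primality using (prime?)
open import Data.Bool using (Bool; true; false; if_then_else_; not; _∧_)
open import Data.Fin using (Fin; fromℕ<)
open import Data.Fin.Subset using (Subset)
open import Data.Vec using (lookup)
open import Data.Vec.Functional using () renaming (_∷_ to _∷ᶠ_)
open import Data.List using (List; []; _∷_; length; filter; upTo)
open import Data.Product using (Σ; ∃; ∃-syntax; _×_; _,_)
open import Relation.Nullary using (¬_)
open import Relation.Nullary.Decidable using (_×-dec_)
open import Relation.Binary.PropositionalEquality using (_≡_)
open import Data.Integer using (ℤ; +_; _-_; ∣_∣)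
open import Data.Rational using (ℚ; _/_)
import Data.Rational as ℚ

BoolFun : ℕ → Set
BoolFun n = (Fin n → Bool) → Bool

-- ω(m): number of distinct primes p (necessarily p ≤ m when m > 0) dividing m
ω : ℕ → ℕ
ω m = length (filter (λ p → prime? p ×-dec p ∣? m) (upTo (suc m)))

-- Circuits of MOD_m^A gates over n inputs, of depth at most h.
-- A gate MOD_m^A has an arbitrary (finite) list of incoming wires; repeated
-- wires are allowed (the same subcircuit may occur several times).
-- Fan-out is modelled by unfolding into a tree, which does not change depth.
data CC (m n : ℕ) : ℕ → Set where
  input : ∀ {h} → Fin n → CC m n h
  gate  : ∀ {h} → Subset m → List (CC m n h) → CC m n (suc h)

b2n : Bool → ℕ
b2n true  = 1
b2n false = 0

mutual
  eval : ∀ {m n h} .{{_ : NonZero m}} → CC m n h → (Fin n → Bool) → Bool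
  eval (input i) x = x i
  eval {m} (gate A cs) x = lookup A (fromℕ< (m%n<n (sumIn cs x) m))

  sumIn : ∀ {m n h} .{{_ : NonZero m}} → List (CC m n h) → (Fin n → Bool) → ℕ
  sumIn []       x = 0
  sumIn (c ∷ cs) x = b2n (eval c x) + sumIn cs x

Computable : (h m : ℕ) .{{_ : NonZero m}} → ∀ {n} → BoolFun n → Set
Computable h m {n} f = Σ (CC m n h) λ C → ∀ x → eval C x ≡ f x

AND : ∀ n → BoolFun n
AND zero    x = true
AND (suc n) x = x Fin.zero ∧ AND n (λ i → x (Fin.suc i))
  where import Data.Fin as Fin

countTrue : ∀ n → BoolFun n → ℕ
countTrue zero    f = if f (λ ()) then 1 else 0
countTrue (suc n) f = countTrue n (λ x → f (false ∷ᶠ x)) + countTrue n (λ x → f (true ∷ᶠ x))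

countFalse : ∀ n → BoolFun n → ℕ
countFalse n f = countTrue n (λ x → not (f x))

NonConstant : ∀ {n} → BoolFun n → Set
NonConstant f = ∃[ x ] ∃[ y ] ¬ (f x ≡ f y)

bal : ∀ n → BoolFun n → ℚ
bal n f = ℚ.1ℚ ℚ.- ((+ ∣ + countFalse n f - + countTrue n f ∣) / (2 ^ n)) {{m^n≢0 2 n}}

-- A function f computed by a single input variable is perfectly balanced. Otherwise f is
-- computed by a top gate MOD_m^A, and so is its negation (by the gate MOD_m^(∁A)). If f had
-- fewer than 2^(n-c) true points, a greedy choice of literals for the variables of the
-- sparser cofactor would exhibit AND_(c+1) as a restriction of f. Restricting the inputs of
-- a MOD_m gate to literals keeps it a MOD_m gate of the same depth: a constant or a negated
-- variable becomes a shift of the accepting set A, since 1 - y ≡ (m - 1) y + 1 (mod m).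
-- So AND_(c+1) would be computable, contradicting the choice of c. Hence both |f⁻¹(1)| and
-- |f⁻¹(0)| are at least 2^(n-c), and bal(f) = 2 min(|f⁻¹(0)|, |f⁻¹(1)|) / 2^n ≥ 2^(1-c).
module Submission where

open import Defs
open import Data.Nat using (ℕ; zero; suc; pred; _+_; _*_; _∸_; _^_; _%_; _⊓_; _≤_; _<_; _<?_; z≤n; s≤s; NonZero; >-nonZero⁻¹)
open import Data.Nat.Properties
open import Data.Nat.DivMod using (_mod_; %-distribˡ-+; m%n%n≡m%n; n%n≡0; m<n⇒m%n≡m)
open import Algebra.Properties.CommutativeSemigroup *-commutativeSemigroup using () renaming (x∙yz≈y∙xz to m*[n*o]≡n*[m*o])
open import Algebra.Properties.CommutativeSemigroup +-commutativeSemigroup using () renaming (x∙yz≈y∙xz to m+[n+o]≡n+[m+o])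
open import Data.Bool using (Bool; true; false; not; _∧_; _xor_; if_then_else_)
open import Data.Bool.Properties using (∧-identityʳ; xor-comm; true-xor; xor-identityʳ)
open import Data.Fin using (Fin; toℕ) renaming (zero to fzero; suc to fsuc)
open import Data.Fin.Properties using (toℕ-fromℕ<; toℕ-injective)
open import Data.Fin.Subset using (Subset; ∁)
open import Data.Vec using (lookup; tabulate)
open import Data.Vec.Properties using (lookup-map; lookup∘tabulate)
open import Data.Vec.Functional using (tail) renaming (_∷_ to _∷ᶠ_)
open import Data.Vec.Functional.Properties using (∷-cong)
open import Data.List using (List; []; _∷_; [_]; _++_; replicate)
open import Data.Product using (Σ; ∃-syntax; _×_; _,_)
open import Data.Sum using (_⊎_; inj₁; inj₂)
open import Function using (_∘_)
open import Relation.Nullary using (yes; no; contradiction)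
open import Relation.Binary.PropositionalEquality hiding ([_])
open import Data.Integer as ℤ using (+_)
import Data.Integer.Properties as ℤP
open import Data.Rational using (_/_; 1ℚ; toℚᵘ)
import Data.Rational as ℚ
import Data.Rational.Properties as ℚP
open import Data.Rational.Unnormalised as ℚᵘ using (mkℚᵘ; 1ℚᵘ; _≃_)
import Data.Rational.Unnormalised.Properties as ℚᵘP

private
  variable
    k n : ℕ

-- Without function extensionality f x and f (x zero ∷ x ∘ suc) need not agree, so this is assumed
-- where a count is split into cofactors; every function computed by a circuit satisfies it.
Extensional : BoolFun n → Set
Extensional f = ∀ {x y} → x ≗ y → f x ≡ f y

cofactor : BoolFun (suc n) → Bool → BoolFun n
cofactor f b x = f (b ∷ᶠ x)

cofactor-extensional : {f : BoolFun (suc n)} → Extensional f → ∀ b → Extensional (cofactor f b)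
cofactor-extensional ext b x≗y = ext (∷-cong refl x≗y)

f≡cofactor-head : {f : BoolFun (suc n)} → Extensional f → ∀ x → f x ≡ cofactor f (x fzero) (tail x)
f≡cofactor-head ext x = ext (∷-cong refl (λ _ → refl))

NonConstant⇒surjective : {f : BoolFun n} → NonConstant f → ∀ b → ∃[ x ] f x ≡ b
NonConstant⇒surjective {f = f} (x , y , fx≢fy) b with f x in fx | f y in fy
NonConstant⇒surjective (x , y , fx≢fy) false | false | _     = x , fx
NonConstant⇒surjective (x , y , fx≢fy) false | true  | false = y , fy
NonConstant⇒surjective (x , y , fx≢fy) true  | true  | _     = x , fx
NonConstant⇒surjective (x , y , fx≢fy) true  | false | true  = y , fy
NonConstant⇒surjective (x , y , fx≢fy) _     | false | false = contradiction refl fx≢fy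
NonConstant⇒surjective (x , y , fx≢fy) _     | true  | true  = contradiction refl fx≢fy

countTrue-cong : ∀ n {f g : BoolFun n} → (∀ x → f x ≡ g x) → countTrue n f ≡ countTrue n g
countTrue-cong zero    f≗g = cong (λ b → if b then 1 else 0) (f≗g _)
countTrue-cong (suc n) f≗g = cong₂ _+_ (countTrue-cong n (f≗g ∘ _)) (countTrue-cong n (f≗g ∘ _))

countTrue-cofactors : ∀ n (f : BoolFun (suc n)) b →
                      countTrue (suc n) f ≡ countTrue n (cofactor f b) + countTrue n (cofactor f (not b))
countTrue-cofactors n f false = refl
countTrue-cofactors n f true  = +-comm (countTrue n (cofactor f false)) _

countTrue+countFalse≡2^n : ∀ n (f : BoolFun n) → countTrue n f + countFalse n f ≡ 2 ^ n
countTrue+countFalse≡2^n zero f = indicator+indicator-not (f (λ ()))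
  where
  indicator+indicator-not : ∀ b → (if b then 1 else 0) + (if not b then 1 else 0) ≡ 1
  indicator+indicator-not true  = refl
  indicator+indicator-not false = refl
countTrue+countFalse≡2^n (suc n) f = begin
  (t₀ + t₁) + (u₀ + u₁) ≡⟨ +-assoc t₀ t₁ (u₀ + u₁) ⟩
  t₀ + (t₁ + (u₀ + u₁)) ≡⟨ cong (λ e → t₀ + e) (m+[n+o]≡n+[m+o] t₁ u₀ u₁) ⟩
  t₀ + (u₀ + (t₁ + u₁)) ≡⟨ sym (+-assoc t₀ u₀ (t₁ + u₁)) ⟩
  (t₀ + u₀) + (t₁ + u₁) ≡⟨ cong₂ _+_ (countTrue+countFalse≡2^n n _) (countTrue+countFalse≡2^n n _) ⟩
  2 ^ n + 2 ^ n         ≡⟨ cong (λ e → 2 ^ n + e) (sym (+-identityʳ (2 ^ n))) ⟩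
  2 ^ suc n             ∎
  where
  open ≡-Reasoning
  t₀ = countTrue n (cofactor f false)
  t₁ = countTrue n (cofactor f true)
  u₀ = countFalse n (cofactor f false)
  u₁ = countFalse n (cofactor f true)

countTrue≡0⇒≡false : ∀ n {f : BoolFun n} → Extensional f → countTrue n f ≡ 0 → ∀ x → f x ≡ false
countTrue≡0⇒≡false zero {f} ext #f≡0 x = trans (ext (λ ())) (indicator≡0 (f (λ ())) #f≡0)
  where
  indicator≡0 : ∀ b → (if b then 1 else 0) ≡ 0 → b ≡ false
  indicator≡0 false _ = refl
countTrue≡0⇒≡false (suc n) {f} ext #f≡0 x = trans (f≡cofactor-head ext x)
  (countTrue≡0⇒≡false n (cofactor-extensional ext (x fzero))
    (m+n≡0⇒m≡0 _ (trans (sym (countTrue-cofactors n f (x fzero))) #f≡0)) (tail x))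

countTrue>0⇒∃ : ∀ n {f : BoolFun n} → 0 < countTrue n f → ∃[ x ] f x ≡ true
countTrue>0⇒∃ zero {f} #f>0 = (λ ()) , indicator>0 (f (λ ())) #f>0
  where
  indicator>0 : ∀ b → 0 < (if b then 1 else 0) → b ≡ true
  indicator>0 true _ = refl
countTrue>0⇒∃ (suc n) {f} #f>0 with countTrue n (cofactor f false) in eq
... | suc _ = let x , fx = countTrue>0⇒∃ n (subst (0 <_) (sym eq) (s≤s z≤n)) in (false ∷ᶠ x) , fx
... | zero  = let x , fx = countTrue>0⇒∃ n #f>0 in (true ∷ᶠ x) , fx

∃⇒countTrue>0 : ∀ n {f : BoolFun n} → Extensional f → ∀ x → f x ≡ true → 0 < countTrue n f
∃⇒countTrue>0 zero {f} ext x fx = indicator>0 (trans (ext (λ ())) fx)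
  where
  indicator>0 : ∀ {b} → b ≡ true → 0 < (if b then 1 else 0)
  indicator>0 refl = s≤s z≤n
∃⇒countTrue>0 (suc n) {f} ext x fx = subst (0 <_) (sym (countTrue-cofactors n f (x fzero)))
  (≤-trans (∃⇒countTrue>0 n (cofactor-extensional ext (x fzero)) (tail x)
             (trans (sym (f≡cofactor-head ext x)) fx))
           (m≤m+n _ _))

countTrue-proj≡countFalse-proj : ∀ n (i : Fin n) → countTrue n (λ x → x i) ≡ countFalse n (λ x → x i)
countTrue-proj≡countFalse-proj (suc n) fzero    = +-comm (countTrue n (λ _ → false)) _
countTrue-proj≡countFalse-proj (suc n) (fsuc i) =
  cong₂ _+_ (countTrue-proj≡countFalse-proj n i) (countTrue-proj≡countFalse-proj n i)

data Literal (k : ℕ) : Set where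
  const   : Bool → Literal k
  pos neg : Fin k → Literal k

evalLiteral : Literal k → (Fin k → Bool) → Bool
evalLiteral (const b) y = b
evalLiteral (pos i)   y = y i
evalLiteral (neg i)   y = not (y i)

mapLiteral : ∀ {j} → (Fin j → Fin k) → Literal j → Literal k
mapLiteral ρ (const b) = const b
mapLiteral ρ (pos i)   = pos (ρ i)
mapLiteral ρ (neg i)   = neg (ρ i)

evalLiteral-map : ∀ {j} (ρ : Fin j → Fin k) l y → evalLiteral (mapLiteral ρ l) y ≡ evalLiteral l (y ∘ ρ)
evalLiteral-map ρ (const b) y = refl
evalLiteral-map ρ (pos i)   y = refl
evalLiteral-map ρ (neg i)   y = refl

substitute : (Fin n → Literal k) → (Fin k → Bool) → Fin n → Bool
substitute σ y i = evalLiteral (σ i) y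

Restriction : BoolFun k → BoolFun n → Set
Restriction {k} {n} g f = Σ (Fin n → Literal k) λ σ → ∀ y → f (substitute σ y) ≡ g y

restriction-of-cofactor : {f : BoolFun (suc n)} {g : BoolFun k} → Extensional f →
                          ∀ b → Restriction g (cofactor f b) → Restriction g f
restriction-of-cofactor ext b (σ , fσ≡g) = const b ∷ᶠ σ , λ y → trans (ext (∷-cong refl (λ _ → refl))) (fσ≡g y)

-- The new first variable y₀ is sent to the literal b xor y₀: for y₀ = false it lands in the
-- vanishing cofactor, for y₀ = true in the cofactor restricting to AND_k.
AND-restriction-step : {f : BoolFun (suc n)} → Extensional f → ∀ b → (∀ x → cofactor f b x ≡ false) →
                       Restriction (AND k) (cofactor f (not b)) → Restriction (AND (suc k)) f
AND-restriction-step {k = k} {f = f} ext b f-b≡false (σ , fσ≡AND) =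
  b-xor-y₀ b ∷ᶠ mapLiteral fsuc ∘ σ , λ y →
    trans (ext (∷-cong (eval-b-xor-y₀ b y) (λ i → evalLiteral-map fsuc (σ i) y))) (cases (y fzero) (tail y))
  where
  b-xor-y₀ : Bool → Literal (suc k)
  b-xor-y₀ false = pos fzero
  b-xor-y₀ true  = neg fzero

  eval-b-xor-y₀ : ∀ b y → evalLiteral (b-xor-y₀ b) y ≡ b xor y fzero
  eval-b-xor-y₀ false y = refl
  eval-b-xor-y₀ true  y = refl

  cases : ∀ y₀ y → f ((b xor y₀) ∷ᶠ substitute σ y) ≡ y₀ ∧ AND k y
  cases true  y = trans (cong (λ v → f (v ∷ᶠ substitute σ y)) (trans (xor-comm b true) (true-xor b))) (fσ≡AND y)
  cases false y = trans (cong (λ v → f (v ∷ᶠ substitute σ y)) (xor-identityʳ b)) (f-b≡false _)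

lighter-cofactor : ∀ n (f : BoolFun (suc n)) →
                   ∃[ b ] countTrue n (cofactor f b) ≤ countTrue n (cofactor f (not b))
lighter-cofactor n f with ≤-total (countTrue n (cofactor f false)) (countTrue n (cofactor f true))
... | inj₁ t₀≤t₁ = false , t₀≤t₁
... | inj₂ t₁≤t₀ = true , t₁≤t₀

a*[2*K]<2*N⇒a*K<N : ∀ a K N → a * (2 * K) < 2 * N → a * K < N
a*[2*K]<2*N⇒a*K<N a K N lt = *-cancelˡ-< 2 _ _ (subst (_< 2 * N) (m*[n*o]≡n*[m*o] a 2 K) lt)

a≤b⇒a*K<N : ∀ a b K N → a ≤ b → (a + b) * K < 2 * N → a * K < N
a≤b⇒a*K<N a b K N a≤b [a+b]K<2N = *-cancelˡ-< 2 _ _ (begin-strict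
  2 * (a * K) ≡⟨ sym (*-assoc 2 a K) ⟩
  2 * a * K   ≤⟨ *-monoˡ-≤ K (+-monoʳ-≤ a (≤-trans (≤-reflexive (+-identityʳ a)) a≤b)) ⟩
  (a + b) * K <⟨ [a+b]K<2N ⟩
  2 * N       ∎)
  where open ≤-Reasoning

AND-restriction : ∀ n k (f : BoolFun n) → Extensional f → 0 < countTrue n f →
                  countTrue n f * 2 ^ k < 2 ^ suc n → Restriction (AND k) f
AND-restriction n zero f ext #f>0 sparse =
  let x , fx = countTrue>0⇒∃ n #f>0 in const ∘ x , λ _ → fx
AND-restriction zero (suc k) f ext #f>0 sparse = contradiction sparse (≤⇒≯ (begin
  2                         ≤⟨ *-monoʳ-≤ 2 (m^n>0 2 k) ⟩
  2 ^ suc k                 ≡⟨ sym (*-identityˡ (2 ^ suc k)) ⟩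
  1 * 2 ^ suc k             ≤⟨ *-monoˡ-≤ (2 ^ suc k) #f>0 ⟩
  countTrue 0 f * 2 ^ suc k ∎))
  where open ≤-Reasoning
AND-restriction (suc n) (suc k) f ext #f>0 sparse with lighter-cofactor n f
... | b , light with countTrue n (cofactor f b) in #f-b | countTrue-cofactors n f b
...   | zero  | #f≡#f¬b = AND-restriction-step ext b
          (countTrue≡0⇒≡false n (cofactor-extensional ext b) #f-b)
          (AND-restriction n k (cofactor f (not b)) (cofactor-extensional ext (not b))
            (subst (0 <_) #f≡#f¬b #f>0)
            (a*[2*K]<2*N⇒a*K<N (countTrue n (cofactor f (not b))) (2 ^ k) (2 ^ suc n)
              (subst (λ t → t * 2 ^ suc k < 2 ^ suc (suc n)) #f≡#f¬b sparse)))
...   | suc t | #f≡#fb+#f¬b = restriction-of-cofactor ext b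
          (AND-restriction n (suc k) (cofactor f b) (cofactor-extensional ext b)
            (subst (0 <_) (sym #f-b) (s≤s z≤n))
            (subst (λ t → t * 2 ^ suc k < 2 ^ suc n) (sym #f-b)
              (a≤b⇒a*K<N (suc t) (countTrue n (cofactor f (not b))) (2 ^ suc k) (2 ^ suc n) light
                (subst (λ t → t * 2 ^ suc k < 2 ^ suc (suc n)) #f≡#fb+#f¬b sparse))))

module _ {m : ℕ} .{{_ : NonZero m}} where

  mutual
    eval-extensional : ∀ {h} (C : CC m n h) → Extensional (eval C)
    eval-extensional (input i)   x≗y = x≗y i
    eval-extensional (gate A cs) x≗y = cong (λ s → lookup A (s mod m)) (sumIn-cong cs x≗y)

    sumIn-cong : ∀ {h} (cs : List (CC m n h)) {x y} → x ≗ y → sumIn cs x ≡ sumIn cs y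
    sumIn-cong []       x≗y = refl
    sumIn-cong (c ∷ cs) x≗y = cong₂ (λ v s → b2n v + s) (eval-extensional c x≗y) (sumIn-cong cs x≗y)

  computed-extensional : ∀ {h} (C : CC m n h) {f : BoolFun n} → (∀ x → eval C x ≡ f x) → Extensional f
  computed-extensional C C≗f {x} {y} x≗y = trans (sym (C≗f x)) (trans (eval-extensional C x≗y) (C≗f y))

  eval-∁ : ∀ {h} (A : Subset m) (cs : List (CC m n h)) x → eval (gate (∁ A) cs) x ≡ not (eval (gate A cs) x)
  eval-∁ A cs x = lookup-map (sumIn cs x mod m) not A

  %-+-cong : ∀ {a b c d} → a % m ≡ c % m → b % m ≡ d % m → (a + b) % m ≡ (c + d) % m
  %-+-cong {a} {b} {c} {d} a≡c b≡d =
    trans (%-distribˡ-+ a b m) (trans (cong₂ (λ u v → (u + v) % m) a≡c b≡d) (sym (%-distribˡ-+ c d m)))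

  mod-cong : ∀ {a b} → a % m ≡ b % m → a mod m ≡ b mod m
  mod-cong a≡b = toℕ-injective (trans (toℕ-fromℕ< _) (trans a≡b (sym (toℕ-fromℕ< _))))

  shift : ℕ → Subset m → Subset m
  shift c A = tabulate λ s → lookup A ((toℕ s + c) mod m)

  lookup-shift : ∀ c A s → lookup (shift c A) (s mod m) ≡ lookup A ((s + c) mod m)
  lookup-shift c A s = trans (lookup∘tabulate _ (s mod m))
    (cong (lookup A) (mod-cong (%-+-cong (trans (cong (_% m) (toℕ-fromℕ< _)) (m%n%n≡m%n s m)) refl)))

  -- A gate input after substitution: the circuits fed into the gate together with a constant
  -- that the gate absorbs into its accepting set by a shift.
  Wires : ℕ → ℕ → Set
  Wires k h = List (CC m k h) × ℕ

  wireSum : ∀ {h} → Wires k h → (Fin k → Bool) → ℕ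
  wireSum (ds , c) y = sumIn ds y + c

  _⊕_ : ∀ {h} → Wires k h → Wires k h → Wires k h
  (ds , c) ⊕ (es , d) = ds ++ es , c + d

  sumIn-++ : ∀ {h} (ds es : List (CC m k h)) y → sumIn (ds ++ es) y ≡ sumIn ds y + sumIn es y
  sumIn-++ []       es y = refl
  sumIn-++ (d ∷ ds) es y = trans (cong (λ s → b2n (eval d y) + s) (sumIn-++ ds es y)) (sym (+-assoc (b2n (eval d y)) _ _))

  wireSum-⊕ : ∀ {h} (v w : Wires k h) y → wireSum (v ⊕ w) y ≡ wireSum v y + wireSum w y
  wireSum-⊕ (ds , c) (es , d) y = begin
    sumIn (ds ++ es) y + (c + d)        ≡⟨ cong (λ s → s + (c + d)) (sumIn-++ ds es y) ⟩
    (sumIn ds y + sumIn es y) + (c + d) ≡⟨ +-assoc (sumIn ds y) (sumIn es y) (c + d) ⟩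
    sumIn ds y + (sumIn es y + (c + d)) ≡⟨ cong (λ s → sumIn ds y + s) (m+[n+o]≡n+[m+o] (sumIn es y) c d) ⟩
    sumIn ds y + (c + (sumIn es y + d)) ≡⟨ sym (+-assoc (sumIn ds y) c _) ⟩
    (sumIn ds y + c) + (sumIn es y + d) ∎
    where open ≡-Reasoning

  sumIn-replicate : ∀ {h} r (i : Fin k) y → sumIn (replicate {A = CC m k h} r (input i)) y ≡ r * b2n (y i)
  sumIn-replicate zero    i y = refl
  sumIn-replicate (suc r) i y = cong (λ s → b2n (y i) + s) (sumIn-replicate r i y)

  literalWires : ∀ {h} → Literal k → Wires k h
  literalWires (const b) = [] , b2n b
  literalWires (pos i)   = [ input i ] , 0
  literalWires (neg i)   = replicate (m ∸ 1) (input i) , 1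

  [m∸1]*b+1≡not-b : ∀ b → ((m ∸ 1) * b2n b + 1) % m ≡ b2n (not b) % m
  [m∸1]*b+1≡not-b false = cong (λ s → (s + 1) % m) (*-zeroʳ (m ∸ 1))
  [m∸1]*b+1≡not-b true  = begin
    ((m ∸ 1) * 1 + 1) % m ≡⟨ cong (λ s → (s + 1) % m) (*-identityʳ (m ∸ 1)) ⟩
    (m ∸ 1 + 1) % m       ≡⟨ cong (_% m) (m∸n+n≡m (>-nonZero⁻¹ m)) ⟩
    m % m                 ≡⟨ n%n≡0 m ⟩
    0                     ≡⟨ sym (m<n⇒m%n≡m (>-nonZero⁻¹ m)) ⟩
    0 % m                 ∎
    where open ≡-Reasoning

  literalWires-sound : ∀ {h} (l : Literal k) y → wireSum (literalWires {h = h} l) y % m ≡ b2n (evalLiteral l y) % m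
  literalWires-sound (const b) y = refl
  literalWires-sound (pos i)   y = cong (_% m) (trans (+-identityʳ _) (+-identityʳ _))
  literalWires-sound {h} (neg i) y =
    trans (cong (λ s → (s + 1) % m) (sumIn-replicate {h} (m ∸ 1) i y)) ([m∸1]*b+1≡not-b (y i))

  gateOn : ∀ {h} → Subset m → Wires k h → CC m k (suc h)
  gateOn A (ds , c) = gate (shift c A) ds

  module _ (σ : Fin n → Literal k) where

    mutual
      wires : ∀ {h} → CC m n h → Wires k h
      wires (input i)   = literalWires (σ i)
      wires (gate A cs) = [ restrictGate A cs ] , 0

      wiresList : ∀ {h} → List (CC m n h) → Wires k h
      wiresList []       = [] , 0
      wiresList (c ∷ cs) = wires c ⊕ wiresList cs

      restrictGate : ∀ {h} → Subset m → List (CC m n h) → CC m k (suc h)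
      restrictGate A cs = gateOn A (wiresList cs)

    mutual
      wires-sound : ∀ {h} (c : CC m n h) y → wireSum (wires c) y % m ≡ b2n (eval c (substitute σ y)) % m
      wires-sound (input i)   y = literalWires-sound (σ i) y
      wires-sound (gate A cs) y = cong (_% m) (trans (+-identityʳ _) (trans (+-identityʳ _)
        (cong b2n (restrictGate-sound A cs y))))

      wiresList-sound : ∀ {h} (cs : List (CC m n h)) y → wireSum (wiresList cs) y % m ≡ sumIn cs (substitute σ y) % m
      wiresList-sound []       y = refl
      wiresList-sound (c ∷ cs) y = trans (cong (_% m) (wireSum-⊕ (wires c) (wiresList cs) y))
        (%-+-cong (wires-sound c y) (wiresList-sound cs y))

      restrictGate-sound : ∀ {h} (A : Subset m) (cs : List (CC m n h)) y →
                           eval (restrictGate A cs) y ≡ eval (gate A cs) (substitute σ y)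
      restrictGate-sound A cs y with wiresList cs | wiresList-sound cs y
      ... | ds , c | sound = trans (lookup-shift c A (sumIn ds y)) (cong (lookup A) (mod-cong sound))

  restriction-of-gate : ∀ {h} (A : Subset m) (cs : List (CC m n h)) {f : BoolFun n} {g : BoolFun k} →
                        (∀ x → eval (gate A cs) x ≡ f x) → Restriction g f → Computable (suc h) m g
  restriction-of-gate A cs gate≗f (σ , fσ≡g) =
    restrictGate σ A cs , λ y → trans (restrictGate-sound σ A cs y) (trans (gate≗f _) (fσ≡g y))

≤-⊓-* : ∀ {a} t u K → a ≤ t * K → a ≤ u * K → a ≤ (t ⊓ u) * K
≤-⊓-* t u K a≤tK a≤uK = subst (_ ≤_) (sym (*-distribʳ-⊓ K t u)) (⊓-glb a≤tK a≤uK)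

projection-dense : ∀ n (i : Fin n) c → 1 ≤ c → 2 ^ n ≤ countTrue n (λ x → x i) * 2 ^ c
projection-dense n i c 1≤c = begin
  2 ^ n                        ≡⟨ sym (countTrue+countFalse≡2^n n (λ x → x i)) ⟩
  t + countFalse n (λ x → x i) ≡⟨ cong (λ s → t + s) (sym (countTrue-proj≡countFalse-proj n i)) ⟩
  t + t                        ≡⟨ cong (λ s → t + s) (sym (+-identityʳ t)) ⟩
  2 * t                        ≡⟨ *-comm 2 t ⟩
  t * 2 ^ 1                    ≤⟨ *-monoʳ-≤ t (^-monoʳ-≤ 2 1≤c) ⟩
  t * 2 ^ c                    ∎
  where
  open ≤-Reasoning
  t = countTrue n (λ x → x i)

gate-dense : ∀ {h m} .{{_ : NonZero m}} c → (∀ k → Computable (suc h) m (AND k) → k ≤ c) →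
             (A : Subset m) (cs : List (CC m n h)) {f : BoolFun n} → (∀ x → eval (gate A cs) x ≡ f x) →
             ∃[ x ] f x ≡ true → 2 ^ n ≤ countTrue n f * 2 ^ c
gate-dense {n = n} c AND≤c A cs {f} gate≗f (x , fx) with countTrue n f * 2 ^ c <? 2 ^ n
... | no dense   = ≮⇒≥ dense
... | yes sparse = contradiction (AND≤c (suc c) (restriction-of-gate A cs gate≗f
        (AND-restriction n (suc c) f ext (∃⇒countTrue>0 n ext x fx) doubled))) 1+n≰n
  where
  ext = computed-extensional (gate A cs) gate≗f
  doubled : countTrue n f * 2 ^ suc c < 2 ^ suc n
  doubled = subst (_< 2 ^ suc n) (sym (m*[n*o]≡n*[m*o] (countTrue n f) 2 (2 ^ c))) (*-monoʳ-< 2 sparse)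

computable-dense : ∀ {h m} .{{_ : NonZero m}} c → (∀ k → Computable h m (AND k) → k ≤ c) →
                   (f : BoolFun n) → Computable h m f → NonConstant f →
                   2 ^ n ≤ (countTrue n f ⊓ countFalse n f) * 2 ^ c
computable-dense {n} c AND≤c f (input i , i≗f) _ = ≤-⊓-* (countTrue n f) (countFalse n f) (2 ^ c)
  (subst (λ t → 2 ^ n ≤ t * 2 ^ c) (sym #f≡#xᵢ) (projection-dense n i c 1≤c))
  (subst (λ t → 2 ^ n ≤ t * 2 ^ c) (sym #¬f≡#xᵢ) (projection-dense n i c 1≤c))
  where
  1≤c = AND≤c 1 (input fzero , λ x → sym (∧-identityʳ (x fzero)))
  #f≡#xᵢ : countTrue n f ≡ countTrue n (λ x → x i)
  #f≡#xᵢ = countTrue-cong n (sym ∘ i≗f)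
  #¬f≡#xᵢ : countFalse n f ≡ countTrue n (λ x → x i)
  #¬f≡#xᵢ = trans (countTrue-cong n (cong not ∘ sym ∘ i≗f)) (sym (countTrue-proj≡countFalse-proj n i))
computable-dense {n} c AND≤c f (gate A cs , gate≗f) nonConstant = ≤-⊓-* (countTrue n f) (countFalse n f) (2 ^ c)
  (gate-dense c AND≤c A cs gate≗f (NonConstant⇒surjective nonConstant true))
  (gate-dense c AND≤c (∁ A) cs (λ x → trans (eval-∁ A cs x) (cong not (gate≗f x)))
    (let x , fx≡false = NonConstant⇒surjective nonConstant false in x , cong not fx≡false))

toℚᵘ-/ : ∀ i d .{{_ : NonZero d}} → toℚᵘ (i / d) ≃ mkℚᵘ i (pred d)
toℚᵘ-/ i (suc d) = ℚP.toℚᵘ-fromℚᵘ (mkℚᵘ i d)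

1-mkℚᵘ≃ : ∀ a d → a ≤ suc d → 1ℚᵘ ℚᵘ.- mkℚᵘ (+ a) d ≃ mkℚᵘ (+ (suc d ∸ a)) d
1-mkℚᵘ≃ a d a≤1+d = ℚᵘ.*≡* (cong₂ ℤ._*_ numerator (cong (λ e → + suc e) (sym (+-identityʳ d))))
  where
  open ≡-Reasoning
  numerator : + 1 ℤ.* + suc d ℤ.+ ℤ.- + a ℤ.* + 1 ≡ + (suc d ∸ a)
  numerator = begin
    + 1 ℤ.* + suc d ℤ.+ ℤ.- + a ℤ.* + 1 ≡⟨ cong₂ ℤ._+_ (ℤP.*-identityˡ (+ suc d)) (ℤP.*-identityʳ (ℤ.- + a)) ⟩
    + suc d ℤ.- + a                     ≡⟨ ℤP.m-n≡m⊖n (suc d) a ⟩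
    suc d ℤ.⊖ a                         ≡⟨ ℤP.⊖-≥ a≤1+d ⟩
    + (suc d ∸ a)                       ∎

1-a/d≡[d∸a]/d : ∀ a d .{{_ : NonZero d}} → a ≤ d → 1ℚ ℚ.- (+ a / d) ≡ + (d ∸ a) / d
1-a/d≡[d∸a]/d a (suc d) a≤d = ℚP.toℚᵘ-injective (begin
  toℚᵘ (1ℚ ℚ.- q)              ≈⟨ ℚP.toℚᵘ-homo-+ 1ℚ (ℚ.- q) ⟩
  1ℚᵘ ℚᵘ.+ toℚᵘ (ℚ.- q)        ≈⟨ ℚᵘP.+-congʳ 1ℚᵘ (ℚᵘP.≃-trans (ℚP.toℚᵘ-homo‿- q) (ℚᵘP.-‿cong (toℚᵘ-/ (+ a) (suc d)))) ⟩
  1ℚᵘ ℚᵘ.- mkℚᵘ (+ a) d        ≈⟨ 1-mkℚᵘ≃ a d a≤d ⟩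
  mkℚᵘ (+ (suc d ∸ a)) d       ≈⟨ ℚᵘP.≃-sym (toℚᵘ-/ (+ (suc d ∸ a)) (suc d)) ⟩
  toℚᵘ (+ (suc d ∸ a) / suc d) ∎)
  where
  open ℚᵘP.≃-Reasoning
  q = + a / suc d

a*d≤b*c⇒a/c≤b/d : ∀ a b c d .{{_ : NonZero c}} .{{_ : NonZero d}} →
                  a * d ≤ b * c → (+ a / c) ℚ.≤ (+ b / d)
a*d≤b*c⇒a/c≤b/d a b (suc c) (suc d) ad≤bc = ℚP.toℚᵘ-cancel-≤
  (ℚᵘP.≤-respˡ-≃ (ℚᵘP.≃-sym (toℚᵘ-/ (+ a) (suc c)))
  (ℚᵘP.≤-respʳ-≃ (ℚᵘP.≃-sym (toℚᵘ-/ (+ b) (suc d)))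
  (ℚᵘ.*≤* (subst₂ ℤ._≤_ (ℤP.pos-* a (suc d)) (ℤP.pos-* b (suc c)) (ℤ.+≤+ ad≤bc)))))

∣+a-+b∣≡a∸b : ∀ {a b} → b ≤ a → ℤ.∣ + a ℤ.- + b ∣ ≡ a ∸ b
∣+a-+b∣≡a∸b {a} {b} b≤a = cong ℤ.∣_∣ (trans (ℤP.m-n≡m⊖n a b) (ℤP.⊖-≥ b≤a))

∣+a-+b∣≡b∸a : ∀ {a b} → a ≤ b → ℤ.∣ + a ℤ.- + b ∣ ≡ b ∸ a
∣+a-+b∣≡b∸a {a} {b} a≤b = trans (cong ℤ.∣_∣ (ℤP.m-n≡m⊖n a b)) (ℤP.∣⊖∣-≤ a≤b)

a+b∸[b∸a]≡2*a : ∀ {a b} → a ≤ b → a + b ∸ (b ∸ a) ≡ 2 * a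
a+b∸[b∸a]≡2*a {a} {b} a≤b = begin
  a + b ∸ (b ∸ a)             ≡⟨ cong (λ e → a + e ∸ (b ∸ a)) (sym (m+[n∸m]≡n a≤b)) ⟩
  a + (a + (b ∸ a)) ∸ (b ∸ a) ≡⟨ cong (_∸ (b ∸ a)) (sym (+-assoc a a (b ∸ a))) ⟩
  a + a + (b ∸ a) ∸ (b ∸ a)   ≡⟨ m+n∸n≡m (a + a) (b ∸ a) ⟩
  a + a                       ≡⟨ cong (λ e → a + e) (sym (+-identityʳ a)) ⟩
  2 * a                       ∎
  where open ≡-Reasoning

1-∣u-t∣/d≡2[t⊓u]/d : ∀ t u d .{{_ : NonZero d}} → t + u ≡ d →
                      1ℚ ℚ.- (+ ℤ.∣ + u ℤ.- + t ∣ / d) ≡ + (2 * (t ⊓ u)) / d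
1-∣u-t∣/d≡2[t⊓u]/d t u d t+u≡d with ≤-total t u
... | inj₁ t≤u = begin
  1ℚ ℚ.- (+ ℤ.∣ + u ℤ.- + t ∣ / d) ≡⟨ cong (λ e → 1ℚ ℚ.- (+ e / d)) (∣+a-+b∣≡a∸b t≤u) ⟩
  1ℚ ℚ.- (+ (u ∸ t) / d)           ≡⟨ 1-a/d≡[d∸a]/d (u ∸ t) d (≤-trans (m∸n≤m u t) (subst (u ≤_) t+u≡d (m≤n+m u t))) ⟩
  + (d ∸ (u ∸ t)) / d              ≡⟨ cong (λ e → + (e ∸ (u ∸ t)) / d) (sym t+u≡d) ⟩
  + (t + u ∸ (u ∸ t)) / d          ≡⟨ cong (λ e → + e / d) (a+b∸[b∸a]≡2*a t≤u) ⟩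
  + (2 * t) / d                    ≡⟨ cong (λ e → + (2 * e) / d) (sym (m≤n⇒m⊓n≡m t≤u)) ⟩
  + (2 * (t ⊓ u)) / d              ∎
  where open ≡-Reasoning
... | inj₂ u≤t = begin
  1ℚ ℚ.- (+ ℤ.∣ + u ℤ.- + t ∣ / d) ≡⟨ cong (λ e → 1ℚ ℚ.- (+ e / d)) (∣+a-+b∣≡b∸a u≤t) ⟩
  1ℚ ℚ.- (+ (t ∸ u) / d)           ≡⟨ 1-a/d≡[d∸a]/d (t ∸ u) d (≤-trans (m∸n≤m t u) (subst (t ≤_) t+u≡d (m≤m+n t u))) ⟩
  + (d ∸ (t ∸ u)) / d              ≡⟨ cong (λ e → + (e ∸ (t ∸ u)) / d) (trans (sym t+u≡d) (+-comm t u)) ⟩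
  + (u + t ∸ (t ∸ u)) / d          ≡⟨ cong (λ e → + e / d) (a+b∸[b∸a]≡2*a u≤t) ⟩
  + (2 * u) / d                    ≡⟨ cong (λ e → + (2 * e) / d) (sym (m≥n⇒m⊓n≡n u≤t)) ⟩
  + (2 * (t ⊓ u)) / d              ∎
  where open ≡-Reasoning

bal≡2[t⊓u]/2^n : ∀ n (f : BoolFun n) → bal n f ≡ ((+ (2 * (countTrue n f ⊓ countFalse n f))) / 2 ^ n) {{m^n≢0 2 n}}
bal≡2[t⊓u]/2^n n f = 1-∣u-t∣/d≡2[t⊓u]/d (countTrue n f) (countFalse n f) (2 ^ n) {{m^n≢0 2 n}}
  (countTrue+countFalse≡2^n n f)

-- The hypothesis h ≡ 1 ⊎ ω m ≡ 1 only serves to guarantee that such a bound c exists.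
corollary2p4 : (h m : ℕ) → .{{_ : NonZero h}} → .{{_ : NonZero m}}
    → (h ≡ 1 ⊎ ω m ≡ 1)
    → (c : ℕ) → (∀ n → Computable h m (AND n) → n Data.Nat.≤ c)
    → ∀ n (f : BoolFun n) → Computable h m f → NonConstant f
    → ((+ 2) / (2 ^ c)) {{m^n≢0 2 c}} Data.Rational.≤ bal n f
corollary2p4 h m _ c AND≤c n f computable nonConstant =
  subst (_ ℚ.≤_) (sym (bal≡2[t⊓u]/2^n n f))
    (a*d≤b*c⇒a/c≤b/d 2 (2 * (countTrue n f ⊓ countFalse n f)) (2 ^ c) (2 ^ n) {{m^n≢0 2 c}} {{m^n≢0 2 n}}
      (subst (2 * 2 ^ n ≤_) (sym (*-assoc 2 (countTrue n f ⊓ countFalse n f) (2 ^ c)))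
        (*-monoʳ-≤ 2 (computable-dense c AND≤c f computable nonConstant))))
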